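{- Let $\Gamma$ be a digraph. A set $W\subseteq V(\Gamma)$ is the set of roots of some maximum out forest of $\Gamma$ if and only if $W$ is a vertex basis of $\Gamma$.
   Context: $\Gamma$ is a finite loopless digraph. A vertex $w$ is reachable from $z$ if $w=z$ or there is a directed path from $z$ to $w$. A vertex basis of $\Gamma$ is a minimal (by inclusion) set of vertices from which all vertices of $\Gamma$ are reachable. A diverging forest is a digraph without circuits in which every vertex has indegree at most 1; its roots are the vertices of indegree 0. A maximum out forest of $\Gamma$ is a spanning subgraph of $\Gamma$ that is a diverging forest and has the maximum possible number of arcs among such subgraphs. -}

module Defs where

open import Data.Nat using (ℕ; _≤_)
open import Data.Fin using (Fin; _≟_)
open import Data.Fin.Subset using (Subset; _∈_; _⊆_; ∣_∣; ⊤)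
open import Data.Vec using (tabulate; lookup)
open import Data.Bool using (_∧_)
open import Data.Product using (Σ; ∃; _×_)
open import Relation.Nullary using (¬_)
open import Relation.Nullary.Decidable using (⌊_⌋)
open import Relation.Binary.PropositionalEquality using (_≡_)
open import Relation.Binary.Construct.Closure.ReflexiveTransitive using (Star)
open import Relation.Binary.Construct.Closure.Transitive using (TransClosure)

-- A finite loopless digraph (multiple arcs allowed): vertices Fin n,
-- arcs Fin m, each arc e goes from tail e to head e, with tail e ≢ head e.
record Digraph : Set where
  field
    n        : ℕ
    m        : ℕ
    tail     : Fin m → Fin n
    head     : Fin m → Fin n
    loopless : ∀ e → ¬ (tail e ≡ head e)
open Digraph public

-- Spanning subgraphs of Γ are given by their arc sets S ⊆ A(Γ).
ArcSet : Digraph → Set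
ArcSet Γ = Subset (m Γ)

VSet : Digraph → Set
VSet Γ = Subset (n Γ)

Step : (Γ : Digraph) → ArcSet Γ → Fin (n Γ) → Fin (n Γ) → Set
Step Γ S u v = ∃ λ e → e ∈ S × tail Γ e ≡ u × head Γ e ≡ v

Reachable : (Γ : Digraph) → Fin (n Γ) → Fin (n Γ) → Set
Reachable Γ z w = Star (Step Γ ⊤) z w

inArcs : (Γ : Digraph) → ArcSet Γ → Fin (n Γ) → ArcSet Γ
inArcs Γ S v = tabulate (λ e → lookup S e ∧ ⌊ head Γ e ≟ v ⌋)

indeg : (Γ : Digraph) → ArcSet Γ → Fin (n Γ) → ℕ
indeg Γ S v = ∣ inArcs Γ S v ∣

HasCircuit : (Γ : Digraph) → ArcSet Γ → Set
HasCircuit Γ S = ∃ λ v → TransClosure (Step Γ S) v v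

IsDivergingForest : (Γ : Digraph) → ArcSet Γ → Set
IsDivergingForest Γ S = ¬ HasCircuit Γ S × (∀ v → indeg Γ S v ≤ 1)

IsMaxOutForest : (Γ : Digraph) → ArcSet Γ → Set
IsMaxOutForest Γ S =
  IsDivergingForest Γ S × (∀ S' → IsDivergingForest Γ S' → ∣ S' ∣ ≤ ∣ S ∣)

IsRootSet : (Γ : Digraph) → ArcSet Γ → VSet Γ → Set
IsRootSet Γ S W = ∀ v → (v ∈ W → indeg Γ S v ≡ 0) × (indeg Γ S v ≡ 0 → v ∈ W)

Spans : (Γ : Digraph) → VSet Γ → Set
Spans Γ W = ∀ v → ∃ λ w → w ∈ W × Reachable Γ w v

IsVertexBasis : (Γ : Digraph) → VSet Γ → Set
IsVertexBasis Γ W = Spans Γ W × (∀ W' → W' ⊆ W → Spans Γ W' → W ⊆ W')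

{-# OPTIONS --safe #-}

-- In a diverging forest every non-root vertex has exactly one entering arc, so
-- a forest with arc set S has n − ∣S∣ roots: maximising arcs means minimising
-- roots. The roots of a forest span Γ, since following entering arcs backwards
-- must stop at a root (a backward walk of n steps would repeat a vertex and
-- close a circuit). Conversely every spanning set W contains the roots of some
-- forest, grown outwards from W one leaving arc at a time. Finally a vertex
-- basis has the least size among spanning sets: distinct basis vertices cannot
-- reach each other, so each is mutually reachable with its own vertex of any
-- spanning set. Hence the roots of a maximum forest form a spanning set with no
-- smaller spanning subset, and a forest grown from a basis has exactly the
-- basis as roots and the fewest possible roots.
module Submission where

open import Defs
open import Data.Product using (∃; _×_; _,_; proj₁; proj₂)

open import Data.Bool using (Bool; true; false; _∧_)
open import Data.Empty using (⊥-elim)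
open import Data.Fin using (Fin; zero; suc; _≟_) renaming (_<_ to _<ᶠ_)
open import Data.Fin.Properties using (any?; pigeonhole)
open import Data.Fin.Subset
  using (Subset; _∈_; _∉_; _⊆_; _⊂_; _⊃_; ∣_∣; _∪_; ⁅_⁆; _-_; Empty)
open import Data.Fin.Subset.Properties
  using ( _∈?_; ∈⊤; nonempty?; Empty-unique; ∣⊥∣≡0; ∣⁅x⁆∣≡1; x∈⁅x⁆; x∈⁅y⁆⇒x≡y
        ; p⊆p∪q; x∈p∪q⁺; x∈p∪q⁻; p─q⊆p; x∈p∧x≢y⇒x∈p-y; x∈p⇒p-x⊂p; x∈p⇒∣p-x∣<∣p∣; p─⊥≡p
        ; p⊆q⇒∣p∣≤∣q∣; p⊂q⇒∣p∣<∣q∣; ⊆-antisym )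
open import Data.Fin.Subset.Induction using (Acc; acc; ⊂-wellFounded; ⊃-wellFounded)
open import Data.Maybe using (Maybe; just; nothing)
open import Data.Maybe.Properties using (just-injective) renaming (≡-dec to ≡-dec-Maybe)
open import Data.Nat using (ℕ; zero; suc; _+_; _≤_; _<_; z≤n; s≤s) renaming (_≟_ to _≟ℕ_)
open import Data.Nat.Properties
  using ( +-0-commutativeMonoid; ≤-refl; ≤-trans; ≤-reflexive; <-trans; <-irrefl; <⇒≱
        ; n<1+n; m<n⇒n≢0; +-mono-≤; +-monoʳ-≤; +-cancelˡ-≤; +-cancelʳ-≤; module ≤-Reasoning )
open import Data.Sum using (_⊎_; inj₁; inj₂)
open import Data.Vec using ([]; _∷_; here; there; tabulate; lookup)
open import Data.Vec.Functional using (updateAt)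
open import Data.Vec.Functional.Properties using (updateAt-updates; updateAt-minimal)
open import Data.Vec.Properties using (lookup∘tabulate; []=⇒lookup; lookup⇒[]=)
open import Function using (_∘_; id; const)
open import Relation.Binary.Construct.Closure.ReflexiveTransitive as Star
  using (Star; ε; _◅_; _◅◅_)
open import Relation.Binary.Construct.Closure.Transitive using (TransClosure; [_])
  renaming (_∷_ to _∷⁺_)
open import Relation.Binary.PropositionalEquality
  using (_≡_; _≢_; refl; sym; trans; cong; cong₂; subst; subst₂; module ≡-Reasoning)
open import Relation.Nullary using (¬_; Dec; yes; no; contradiction; _×-dec_; ¬?)
open import Relation.Nullary.Decidable using (⌊_⌋; dec-true; isYes≗does; decidable-stable)

open import Algebra.Properties.CommutativeMonoid.Sum +-0-commutativeMonoid
  using (sum-syntax; sum-cong-≗; sum-replicate-zero; ∑-comm; ∑-distrib-+)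

∣Empty∣≡0 : ∀ {k} {p : Subset k} → Empty p → ∣ p ∣ ≡ 0
∣Empty∣≡0 {k} p-empty = trans (cong ∣_∣ (Empty-unique p-empty)) (∣⊥∣≡0 k)

⌊⌋≡true : ∀ {A : Set} (a? : Dec A) → A → ⌊ a? ⌋ ≡ true
⌊⌋≡true a? a = trans (isYes≗does a?) (dec-true a? a)

∈-tabulate⁺ : ∀ {k} {f : Fin k → Bool} {x} → f x ≡ true → x ∈ tabulate f
∈-tabulate⁺ {f = f} {x} fx = lookup⇒[]= x (tabulate f) (trans (lookup∘tabulate f x) fx)

∈-tabulate⁻ : ∀ {k} {f : Fin k → Bool} {x} → x ∈ tabulate f → f x ≡ true
∈-tabulate⁻ {f = f} {x} x∈ = trans (sym (lookup∘tabulate f x)) ([]=⇒lookup x∈)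

x∉p⇒p⊂p∪⁅x⁆ : ∀ {k} {p : Subset k} {x} → x ∉ p → p ⊂ p ∪ ⁅ x ⁆
x∉p⇒p⊂p∪⁅x⁆ {x = x} x∉p = p⊆p∪q ⁅ x ⁆ , x , x∈p∪q⁺ (inj₂ (x∈⁅x⁆ x)) , x∉p

x∉p-x : ∀ {k} {p : Subset k} {x : Fin k} → x ∉ p - x
x∉p-x {p = true  ∷ p} {zero}  ()
x∉p-x {p = false ∷ p} {zero}  ()
x∉p-x {p = _     ∷ p} {suc x} (there x∈) = x∉p-x {p = p} x∈

∣p∣≡1+∣p-x∣ : ∀ {k} {p : Subset k} {x : Fin k} → x ∈ p → ∣ p ∣ ≡ suc ∣ p - x ∣
∣p∣≡1+∣p-x∣ {p = true ∷ p}  {zero}  here      = cong (suc ∘ ∣_∣) (sym (p─⊥≡p p))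
∣p∣≡1+∣p-x∣ {p = true ∷ p}  {suc x} (there x∈) = cong suc (∣p∣≡1+∣p-x∣ x∈)
∣p∣≡1+∣p-x∣ {p = false ∷ p} {suc x} (there x∈) = ∣p∣≡1+∣p-x∣ x∈

p⊆q∧∣q∣≤∣p∣⇒q⊆p : ∀ {k} {p q : Subset k} → p ⊆ q → ∣ q ∣ ≤ ∣ p ∣ → q ⊆ p
p⊆q∧∣q∣≤∣p∣⇒q⊆p {p = p} p⊆q ∣q∣≤∣p∣ {x} x∈q with x ∈? p
... | yes x∈p = x∈p
... | no  x∉p = contradiction ∣q∣≤∣p∣ (<⇒≱ (p⊂q⇒∣p∣<∣q∣ (p⊆q , x , x∈q , x∉p)))

injection⇒∣p∣≤∣q∣ : ∀ {k l} (M : Fin k → Fin l → Set) {p : Subset k} {q : Subset l} → Acc _⊂_ p →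
                    (∀ {x} → x ∈ p → ∃ λ y → y ∈ q × M x y) →
                    (∀ {x x′ y} → x ∈ p → x′ ∈ p → M x y → M x′ y → x ≡ x′) → ∣ p ∣ ≤ ∣ q ∣
injection⇒∣p∣≤∣q∣ M {p} {q} (acc smaller) f f-injective with nonempty? p
... | no p-empty = ≤-trans (≤-reflexive (∣Empty∣≡0 p-empty)) z≤n
... | yes (x , x∈p) with f x∈p
...   | y , y∈q , Mxy = begin
  ∣ p ∣          ≡⟨ ∣p∣≡1+∣p-x∣ x∈p ⟩
  suc ∣ p - x ∣  ≤⟨ s≤s (injection⇒∣p∣≤∣q∣ M (smaller (x∈p⇒p-x⊂p x∈p)) f′ injective′) ⟩
  suc ∣ q - y ∣  ≡⟨ sym (∣p∣≡1+∣p-x∣ y∈q) ⟩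
  ∣ q ∣          ∎
  where
  open ≤-Reasoning
  p-x⊆p : p - x ⊆ p
  p-x⊆p = p─q⊆p p ⁅ x ⁆
  f′ : ∀ {x′} → x′ ∈ p - x → ∃ λ y′ → y′ ∈ q - y × M x′ y′
  f′ x′∈ with f (p-x⊆p x′∈)
  ... | y′ , y′∈q , Mx′y′ = y′ , x∈p∧x≢y⇒x∈p-y y′∈q y′≢y , Mx′y′
    where
    y′≢y : y′ ≢ y
    y′≢y refl = x∉p-x {p = p} (subst (_∈ p - x) (f-injective (p-x⊆p x′∈) x∈p Mx′y′ Mxy) x′∈)
  injective′ : ∀ {x₁ x₂ y′} → x₁ ∈ p - x → x₂ ∈ p - x → M x₁ y′ → M x₂ y′ → x₁ ≡ x₂
  injective′ x₁∈ x₂∈ = f-injective (p-x⊆p x₁∈) (p-x⊆p x₂∈)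

boolToℕ : Bool → ℕ
boolToℕ true  = 1
boolToℕ false = 0

∣p∣≡∑ : ∀ {k} (p : Subset k) → ∣ p ∣ ≡ ∑[ i < k ] boolToℕ (lookup p i)
∣p∣≡∑ []          = refl
∣p∣≡∑ (true ∷ p)  = cong suc (∣p∣≡∑ p)
∣p∣≡∑ (false ∷ p) = ∣p∣≡∑ p

∣tabulate∣≡∑ : ∀ {k} (f : Fin k → Bool) → ∣ tabulate f ∣ ≡ ∑[ i < k ] boolToℕ (f i)
∣tabulate∣≡∑ f = trans (∣p∣≡∑ (tabulate f)) (sum-cong-≗ (cong boolToℕ ∘ lookup∘tabulate f))

∑1≡n : ∀ k → ∑[ i < k ] 1 ≡ k
∑1≡n zero    = refl
∑1≡n (suc k) = cong suc (∑1≡n k)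

∑-δ : ∀ {k} (x : Fin k) → ∑[ v < k ] boolToℕ ⌊ x ≟ v ⌋ ≡ 1
∑-δ {suc k} zero    = cong suc (sum-replicate-zero k)
∑-δ         (suc x) = trans (sum-cong-≗ (cong boolToℕ ∘ ≟-suc)) (∑-δ x)
  where
  -- ⌊_⌋ (isYes) is stuck on the map′ in Fin's _≟_, while does reduces through it.
  ≟-suc : ∀ v → ⌊ suc x ≟ suc v ⌋ ≡ ⌊ x ≟ v ⌋
  ≟-suc v = trans (isYes≗does (suc x ≟ suc v)) (sym (isYes≗does (x ≟ v)))

module _ {k : ℕ} {R : Fin k → Fin k → Set} where

  private
    record Chain (ℓ : ℕ) (v : Fin k) : Set where
      field
        vertex    : Fin (suc ℓ) → Fin k
        ascending : ∀ {i j} → i <ᶠ j → TransClosure R (vertex i) (vertex j)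
        reaches   : Star R (vertex zero) v
    open Chain

    trivialChain : ∀ v → Chain 0 v
    trivialChain v = record { vertex = const v ; ascending = λ { {zero} {zero} () } ; reaches = ε }

    extendChain : ∀ {ℓ u v} (c : Chain ℓ v) → R u (vertex c zero) → Chain (suc ℓ) v
    extendChain {u = u} c r =
      record { vertex = vertex′ ; ascending = ascending′ ; reaches = r ◅ reaches c }
      where
      vertex′ : Fin _ → Fin k
      vertex′ zero    = u
      vertex′ (suc i) = vertex c i
      ascending′ : ∀ {i j} → i <ᶠ j → TransClosure R (vertex′ i) (vertex′ j)
      ascending′ {zero}  {suc zero}    _         = [ r ]
      ascending′ {zero}  {suc (suc j)} _         = r ∷⁺ ascending c {zero} {suc j} (s≤s z≤n)
      ascending′ {suc i} {suc j}       (s≤s i<j) = ascending c i<j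

    sourceOrChain : (P : Fin k → Set) → (∀ v → P v ⊎ ∃ λ u → R u v) →
                    ∀ ℓ v → (∃ λ u → P u × Star R u v) ⊎ Chain ℓ v
    sourceOrChain P P-or-predecessor zero    v = inj₂ (trivialChain v)
    sourceOrChain P P-or-predecessor (suc ℓ) v with sourceOrChain P P-or-predecessor ℓ v
    ... | inj₁ found = inj₁ found
    ... | inj₂ c with P-or-predecessor (vertex c zero)
    ...   | inj₁ p          = inj₁ (vertex c zero , p , reaches c)
    ...   | inj₂ (u , u→c₀) = inj₂ (extendChain c u→c₀)

  acyclic⇒reachableFrom : (P : Fin k → Set) → (∀ v → ¬ TransClosure R v v) →
                          (∀ v → P v ⊎ ∃ λ u → R u v) → ∀ v → ∃ λ u → P u × Star R u v
  acyclic⇒reachableFrom P acyclic P-or-predecessor v with sourceOrChain P P-or-predecessor k v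
  ... | inj₁ found = found
  ... | inj₂ c with pigeonhole (n<1+n k) (vertex c)
  ...   | i , j , i<j , cᵢ≡cⱼ =
          ⊥-elim (acyclic _ (subst (TransClosure R (vertex c i)) (sym cᵢ≡cⱼ) (ascending c i<j)))

roots : (Γ : Digraph) → ArcSet Γ → VSet Γ
roots Γ S = tabulate (λ v → ⌊ indeg Γ S v ≟ℕ 0 ⌋)

module _ (Γ : Digraph) (S : ArcSet Γ) where

  ∈inArcs⁺ : ∀ {e v} → e ∈ S → head Γ e ≡ v → e ∈ inArcs Γ S v
  ∈inArcs⁺ e∈S he = ∈-tabulate⁺ (cong₂ _∧_ ([]=⇒lookup e∈S) (⌊⌋≡true (_ ≟ _) he))

  ∈inArcs⁻ : ∀ {e v} → e ∈ inArcs Γ S v → e ∈ S × head Γ e ≡ v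
  ∈inArcs⁻ {e} {v} e∈ with lookup S e in e∈S | head Γ e ≟ v | ∈-tabulate⁻ e∈
  ... | true | yes he | _ = lookup⇒[]= e S e∈S , he

  ∈roots⁺ : ∀ {v} → indeg Γ S v ≡ 0 → v ∈ roots Γ S
  ∈roots⁺ d≡0 = ∈-tabulate⁺ (⌊⌋≡true (_ ≟ℕ 0) d≡0)

  ∈roots⁻ : ∀ {v} → v ∈ roots Γ S → indeg Γ S v ≡ 0
  ∈roots⁻ {v} v∈ with indeg Γ S v ≟ℕ 0 | ∈-tabulate⁻ v∈
  ... | yes d≡0 | _ = d≡0

  roots-isRootSet : IsRootSet Γ S (roots Γ S)
  roots-isRootSet v = ∈roots⁻ , ∈roots⁺

  isRootSet⇒≡roots : ∀ {W} → IsRootSet Γ S W → W ≡ roots Γ S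
  isRootSet⇒≡roots R = ⊆-antisym (λ {v} v∈W → ∈roots⁺ (proj₁ (R v) v∈W))
                                 (λ {v} v∈  → proj₂ (R v) (∈roots⁻ v∈))

∑indeg≡∣S∣ : (Γ : Digraph) (S : ArcSet Γ) → ∑[ v < n Γ ] indeg Γ S v ≡ ∣ S ∣
∑indeg≡∣S∣ Γ S = begin
  ∑[ v < n Γ ] indeg Γ S v                          ≡⟨ sum-cong-≗ (λ v → ∣tabulate∣≡∑ (λ e → entering e v)) ⟩
  ∑[ v < n Γ ] ∑[ e < m Γ ] boolToℕ (entering e v)  ≡⟨ ∑-comm (λ v e → boolToℕ (entering e v)) ⟩
  ∑[ e < m Γ ] ∑[ v < n Γ ] boolToℕ (entering e v)  ≡⟨ sum-cong-≗ (λ e → ∑-∧-δ (lookup S e) (head Γ e)) ⟩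
  ∑[ e < m Γ ] boolToℕ (lookup S e)                 ≡⟨ sym (∣p∣≡∑ S) ⟩
  ∣ S ∣                                             ∎
  where
  open ≡-Reasoning
  entering : Fin (m Γ) → Fin (n Γ) → Bool
  entering e v = lookup S e ∧ ⌊ head Γ e ≟ v ⌋
  ∑-∧-δ : ∀ b x → ∑[ v < n Γ ] boolToℕ (b ∧ ⌊ x ≟ v ⌋) ≡ boolToℕ b
  ∑-∧-δ true  x = ∑-δ x
  ∑-∧-δ false x = sum-replicate-zero (n Γ)

∣S∣+∣roots∣≡n : (Γ : Digraph) (S : ArcSet Γ) → (∀ v → indeg Γ S v ≤ 1) →
                ∣ S ∣ + ∣ roots Γ S ∣ ≡ n Γ
∣S∣+∣roots∣≡n Γ S indeg≤1 = begin
  ∣ S ∣ + ∣ roots Γ S ∣                   ≡⟨ cong₂ _+_ (sym (∑indeg≡∣S∣ Γ S)) (∣tabulate∣≡∑ (λ v → ⌊ d v ≟ℕ 0 ⌋)) ⟩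
  ∑[ v < n Γ ] d v + ∑[ v < n Γ ] isRoot v  ≡⟨ sym (∑-distrib-+ d isRoot) ⟩
  ∑[ v < n Γ ] (d v + isRoot v)             ≡⟨ sum-cong-≗ (λ v → d+[d≡0]≡1 (indeg≤1 v)) ⟩
  ∑[ v < n Γ ] 1                            ≡⟨ ∑1≡n (n Γ) ⟩
  n Γ                                       ∎
  where
  open ≡-Reasoning
  d : Fin (n Γ) → ℕ
  d = indeg Γ S
  isRoot : Fin (n Γ) → ℕ
  isRoot v = boolToℕ ⌊ d v ≟ℕ 0 ⌋
  d+[d≡0]≡1 : ∀ {x} → x ≤ 1 → x + boolToℕ ⌊ x ≟ℕ 0 ⌋ ≡ 1
  d+[d≡0]≡1 z≤n       = refl
  d+[d≡0]≡1 (s≤s z≤n) = refl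

root⊎entered : (Γ : Digraph) (S : ArcSet Γ) → ∀ v → v ∈ roots Γ S ⊎ ∃ λ u → Step Γ S u v
root⊎entered Γ S v with nonempty? (inArcs Γ S v)
... | no empty = inj₁ (∈roots⁺ Γ S (∣Empty∣≡0 empty))
... | yes (e , e∈) with ∈inArcs⁻ Γ S e∈
...   | e∈S , he = inj₂ (tail Γ e , e , e∈S , refl , he)

roots-spans : (Γ : Digraph) (S : ArcSet Γ) → ¬ HasCircuit Γ S → Spans Γ (roots Γ S)
roots-spans Γ S acyclic v
  with acyclic⇒reachableFrom (_∈ roots Γ S) (λ u c → acyclic (u , c)) (root⊎entered Γ S) v
... | r , r∈roots , r↝v = r , r∈roots , Star.map (λ (e , _ , te , he) → e , ∈⊤ , te , he) r↝v

IsOutClosed : (Γ : Digraph) → VSet Γ → Set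
IsOutClosed Γ C = ∀ e → tail Γ e ∈ C → head Γ e ∈ C

module _ {Γ : Digraph} {C : VSet Γ} (closed : IsOutClosed Γ C) where

  outClosed-reachable : ∀ {u v} → Reachable Γ u v → u ∈ C → v ∈ C
  outClosed-reachable ε                          u∈C = u∈C
  outClosed-reachable ((e , _ , refl , refl) ◅ p) u∈C = outClosed-reachable p (closed e u∈C)

  outClosed-spanning⇒full : ∀ {W} → Spans Γ W → W ⊆ C → ∀ v → v ∈ C
  outClosed-spanning⇒full spans W⊆C v with spans v
  ... | w , w∈W , w↝v = outClosed-reachable w↝v (W⊆C w∈W)

leavingArc? : (Γ : Digraph) (C : VSet Γ) → (∃ λ e → tail Γ e ∈ C × head Γ e ∉ C) ⊎ IsOutClosed Γ C
leavingArc? Γ C with any? (λ e → (tail Γ e ∈? C) ×-dec ¬? (head Γ e ∈? C))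
... | yes leaving = inj₁ leaving
... | no none     = inj₂ λ e t∈C → decidable-stable (head Γ e ∈? C) (λ h∉C → none (e , t∈C , h∉C))

-- A branching given by parent pointers along which a rank strictly increases;
-- C is the set of vertices reached so far, and the parentless ones among them lie in W.
record Branching (Γ : Digraph) (W C : VSet Γ) : Set where
  field
    parent      : Fin (n Γ) → Maybe (Fin (m Γ))
    rank        : Fin (n Γ) → ℕ
    parent-head : ∀ {v e} → parent v ≡ just e → head Γ e ≡ v
    parent-tail : ∀ {v e} → parent v ≡ just e → tail Γ e ∈ C
    parent-rank : ∀ {v e} → parent v ≡ just e → rank (tail Γ e) < rank v
    orphan∈W    : ∀ {v} → v ∈ C → parent v ≡ nothing → v ∈ W

module _ {Γ : Digraph} {W : VSet Γ} where

  trivialBranching : Branching Γ W W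
  trivialBranching = record
    { parent      = const nothing
    ; rank        = const 0
    ; parent-head = λ ()
    ; parent-tail = λ ()
    ; parent-rank = λ ()
    ; orphan∈W    = λ v∈W _ → v∈W
    }

  extendBranching : ∀ {C} → Branching Γ W C → ∀ {e} → tail Γ e ∈ C → head Γ e ∉ C →
                    Branching Γ W (C ∪ ⁅ head Γ e ⁆)
  extendBranching {C} B {e} t∈C x∉C = record
    { parent      = parent′
    ; rank        = rank′
    ; parent-head = parent′-head
    ; parent-tail = parent′-tail
    ; parent-rank = parent′-rank
    ; orphan∈W    = orphan′∈W
    }
    where
    open Branching B
    x : Fin (n Γ)
    x = head Γ e
    parent′ : Fin (n Γ) → Maybe (Fin (m Γ))
    parent′ = updateAt parent x (const (just e))
    rank′ : Fin (n Γ) → ℕ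
    rank′ = updateAt rank x (const (suc (rank (tail Γ e))))

    C⊆C′ : C ⊆ C ∪ ⁅ x ⁆
    C⊆C′ = p⊆p∪q ⁅ x ⁆

    rank′-old : ∀ {u} → u ∈ C → rank′ u ≡ rank u
    rank′-old {u} u∈C = updateAt-minimal u x rank λ { refl → x∉C u∈C }

    parent′-cases : ∀ {v e′} → parent′ v ≡ just e′ → (v ≡ x × e′ ≡ e) ⊎ (v ≢ x × parent v ≡ just e′)
    parent′-cases {v} p with v ≟ x
    ... | yes refl = inj₁ (refl , just-injective (trans (sym p) (updateAt-updates x parent)))
    ... | no v≢x   = inj₂ (v≢x , trans (sym (updateAt-minimal v x parent v≢x)) p)

    parent′-head : ∀ {v e′} → parent′ v ≡ just e′ → head Γ e′ ≡ v
    parent′-head p with parent′-cases p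
    ... | inj₁ (refl , refl) = refl
    ... | inj₂ (_ , q)       = parent-head q

    parent′-tail : ∀ {v e′} → parent′ v ≡ just e′ → tail Γ e′ ∈ C ∪ ⁅ x ⁆
    parent′-tail p with parent′-cases p
    ... | inj₁ (refl , refl) = C⊆C′ t∈C
    ... | inj₂ (_ , q)       = C⊆C′ (parent-tail q)

    parent′-rank : ∀ {v e′} → parent′ v ≡ just e′ → rank′ (tail Γ e′) < rank′ v
    parent′-rank p with parent′-cases p
    ... | inj₁ (refl , refl) =
      subst₂ _<_ (sym (rank′-old t∈C)) (sym (updateAt-updates x rank)) ≤-refl
    ... | inj₂ (v≢x , q) =
      subst₂ _<_ (sym (rank′-old (parent-tail q))) (sym (updateAt-minimal _ x rank v≢x)) (parent-rank q)

    orphan′∈W : ∀ {v} → v ∈ C ∪ ⁅ x ⁆ → parent′ v ≡ nothing → v ∈ W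
    orphan′∈W {v} v∈C′ p with v ≟ x | x∈p∪q⁻ C ⁅ x ⁆ v∈C′
    ... | yes refl | _ with () ← trans (sym p) (updateAt-updates x parent)
    ... | no v≢x | inj₁ v∈C  = orphan∈W v∈C (trans (sym (updateAt-minimal v x parent v≢x)) p)
    ... | no v≢x | inj₂ v∈x  = contradiction (x∈⁅y⁆⇒x≡y x v∈x) v≢x

  module _ {C : VSet Γ} (B : Branching Γ W C) where
    open Branching B

    parentArcs : ArcSet Γ
    parentArcs = tabulate (λ e → ⌊ ≡-dec-Maybe _≟_ (parent (head Γ e)) (just e) ⌋)

    ∈parentArcs⁺ : ∀ {e} → parent (head Γ e) ≡ just e → e ∈ parentArcs
    ∈parentArcs⁺ p = ∈-tabulate⁺ (⌊⌋≡true (≡-dec-Maybe _≟_ _ _) p)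

    ∈parentArcs⁻ : ∀ {e} → e ∈ parentArcs → parent (head Γ e) ≡ just e
    ∈parentArcs⁻ {e} e∈ with ≡-dec-Maybe _≟_ (parent (head Γ e)) (just e) | ∈-tabulate⁻ e∈
    ... | yes p | _ = p

    entering⇒parent : ∀ {e v} → e ∈ inArcs Γ parentArcs v → parent v ≡ just e
    entering⇒parent {e} e∈ with ∈inArcs⁻ Γ parentArcs e∈
    ... | e∈arcs , refl = ∈parentArcs⁻ e∈arcs

    parentArcs-acyclic : ¬ HasCircuit Γ parentArcs
    parentArcs-acyclic (v , circuit) = <-irrefl refl (rank-increases⁺ circuit)
      where
      rank-increases : ∀ {u v} → Step Γ parentArcs u v → rank u < rank v
      rank-increases (e , e∈ , refl , refl) = parent-rank (∈parentArcs⁻ e∈)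
      rank-increases⁺ : ∀ {u v} → TransClosure (Step Γ parentArcs) u v → rank u < rank v
      rank-increases⁺ [ s ]     = rank-increases s
      rank-increases⁺ (s ∷⁺ ss) = <-trans (rank-increases s) (rank-increases⁺ ss)

    parentArcs-indeg≤1 : ∀ v → indeg Γ parentArcs v ≤ 1
    parentArcs-indeg≤1 v with parent v in eq
    ... | nothing = ≤-trans (≤-reflexive (∣Empty∣≡0 noneEntering)) z≤n
      where
      noneEntering : Empty (inArcs Γ parentArcs v)
      noneEntering (e , e∈) with () ← trans (sym eq) (entering⇒parent e∈)
    ... | just e = ≤-trans (p⊆q⇒∣p∣≤∣q∣ entering⊆⁅e⁆) (≤-reflexive (∣⁅x⁆∣≡1 e))
      where
      entering⊆⁅e⁆ : inArcs Γ parentArcs v ⊆ ⁅ e ⁆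
      entering⊆⁅e⁆ e′∈ with trans (sym eq) (entering⇒parent e′∈)
      ... | refl = x∈⁅x⁆ e

    parentArcs-isDivergingForest : IsDivergingForest Γ parentArcs
    parentArcs-isDivergingForest = parentArcs-acyclic , parentArcs-indeg≤1

    roots-parentless : ∀ {v} → v ∈ roots Γ parentArcs → parent v ≡ nothing
    roots-parentless {v} v∈roots with parent v in eq
    ... | nothing = refl
    ... | just e with parent-head eq
    ...   | refl = contradiction (∈roots⁻ Γ parentArcs v∈roots)
                     (m<n⇒n≢0 (x∈p⇒∣p-x∣<∣p∣ (∈inArcs⁺ Γ parentArcs (∈parentArcs⁺ eq) refl)))

  growBranching : ∀ {C} → Acc _⊃_ C → Branching Γ W C →
                  ∃ λ C′ → C ⊆ C′ × IsOutClosed Γ C′ × Branching Γ W C′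
  growBranching {C} (acc larger) B with leavingArc? Γ C
  ... | inj₂ closed = C , id , closed , B
  ... | inj₁ (e , t∈C , x∉C)
    with growBranching (larger (x∉p⇒p⊂p∪⁅x⁆ x∉C)) (extendBranching B t∈C x∉C)
  ...   | C′ , C∪x⊆C′ , closed , B′ = C′ , C∪x⊆C′ ∘ p⊆p∪q _ , closed , B′

spanning⇒forestRootedIn : (Γ : Digraph) (W : VSet Γ) → Spans Γ W →
                          ∃ λ S → IsDivergingForest Γ S × roots Γ S ⊆ W
spanning⇒forestRootedIn Γ W spans with growBranching (⊃-wellFounded W) (trivialBranching {Γ} {W})
... | C , W⊆C , closed , B =
  parentArcs B , parentArcs-isDivergingForest B ,
  λ {v} v∈roots → Branching.orphan∈W B (outClosed-spanning⇒full {Γ} closed spans W⊆C v)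
                                        (roots-parentless B v∈roots)

module _ {Γ : Digraph} {W : VSet Γ} (basis : IsVertexBasis Γ W) where

  basis-antichain : ∀ {w₁ w₂} → w₁ ∈ W → w₂ ∈ W → Reachable Γ w₁ w₂ → w₁ ≡ w₂
  basis-antichain {w₁} {w₂} w₁∈W w₂∈W w₁↝w₂ with w₁ ≟ w₂
  ... | yes w₁≡w₂ = w₁≡w₂
  ... | no  w₁≢w₂ with x∈p⇒p-x⊂p w₂∈W
  ...   | _ , y , y∈W , y∉W-w₂ =
          contradiction (proj₂ basis (W - w₂) (p─q⊆p W ⁅ w₂ ⁆) spans′ y∈W) y∉W-w₂
    where
    spans′ : Spans Γ (W - w₂)
    spans′ v with proj₁ basis v
    ... | w , w∈W , w↝v with w ≟ w₂
    ...   | yes refl = w₁ , x∈p∧x≢y⇒x∈p-y w₁∈W w₁≢w₂ , w₁↝w₂ ◅◅ w↝v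
    ...   | no  w≢w₂ = w , x∈p∧x≢y⇒x∈p-y w∈W w≢w₂ , w↝v

  basis-∣∣-minimum : ∀ {R} → Spans Γ R → ∣ W ∣ ≤ ∣ R ∣
  basis-∣∣-minimum {R} spansR =
    injection⇒∣p∣≤∣q∣ MutuallyReachable (⊂-wellFounded W) partner injective
    where
    MutuallyReachable : Fin (n Γ) → Fin (n Γ) → Set
    MutuallyReachable u v = Reachable Γ u v × Reachable Γ v u
    partner : ∀ {w} → w ∈ W → ∃ λ r → r ∈ R × MutuallyReachable w r
    partner {w} w∈W with spansR w
    ... | r , r∈R , r↝w with proj₁ basis r
    ...   | w′ , w′∈W , w′↝r with basis-antichain w′∈W w∈W (w′↝r ◅◅ r↝w)
    ...     | refl = r , r∈R , w′↝r , r↝w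
    injective : ∀ {w w′ r} → w ∈ W → w′ ∈ W →
                MutuallyReachable w r → MutuallyReachable w′ r → w ≡ w′
    injective w∈W w′∈W (w↝r , _) (_ , r↝w′) = basis-antichain w∈W w′∈W (w↝r ◅◅ r↝w′)

maxOutForest⇒roots-isVertexBasis : (Γ : Digraph) (S : ArcSet Γ) →
                                   IsMaxOutForest Γ S → IsVertexBasis Γ (roots Γ S)
maxOutForest⇒roots-isVertexBasis Γ S ((acyclic , indeg≤1) , maximum) =
  roots-spans Γ S acyclic , minimal
  where
  minimal : ∀ W → W ⊆ roots Γ S → Spans Γ W → roots Γ S ⊆ W
  minimal W W⊆roots spansW with spanning⇒forestRootedIn Γ W spansW
  ... | S′ , forest′@(_ , indeg′≤1) , roots′⊆W =
    p⊆q∧∣q∣≤∣p∣⇒q⊆p W⊆roots (+-cancelˡ-≤ ∣ S ∣ _ _ (begin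
      ∣ S ∣ + ∣ roots Γ S ∣    ≡⟨ ∣S∣+∣roots∣≡n Γ S indeg≤1 ⟩
      n Γ                      ≡⟨ sym (∣S∣+∣roots∣≡n Γ S′ indeg′≤1) ⟩
      ∣ S′ ∣ + ∣ roots Γ S′ ∣  ≤⟨ +-mono-≤ (maximum S′ forest′) (p⊆q⇒∣p∣≤∣q∣ roots′⊆W) ⟩
      ∣ S ∣ + ∣ W ∣            ∎))
    where open ≤-Reasoning

vertexBasis⇒maxOutForest : (Γ : Digraph) (W : VSet Γ) → IsVertexBasis Γ W →
                           ∃ λ S → IsMaxOutForest Γ S × roots Γ S ≡ W
vertexBasis⇒maxOutForest Γ W basis@(spansW , minimal) with spanning⇒forestRootedIn Γ W spansW
... | S , forest@(acyclic , indeg≤1) , roots⊆W = S , (forest , maximum) , roots≡W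
  where
  roots≡W : roots Γ S ≡ W
  roots≡W = ⊆-antisym roots⊆W (minimal (roots Γ S) roots⊆W (roots-spans Γ S acyclic))
  maximum : ∀ S′ → IsDivergingForest Γ S′ → ∣ S′ ∣ ≤ ∣ S ∣
  maximum S′ (acyclic′ , indeg′≤1) = +-cancelʳ-≤ ∣ W ∣ _ _ (begin
    ∣ S′ ∣ + ∣ W ∣            ≤⟨ +-monoʳ-≤ ∣ S′ ∣ (basis-∣∣-minimum {Γ} {W} basis (roots-spans Γ S′ acyclic′)) ⟩
    ∣ S′ ∣ + ∣ roots Γ S′ ∣  ≡⟨ ∣S∣+∣roots∣≡n Γ S′ indeg′≤1 ⟩
    n Γ                       ≡⟨ sym (∣S∣+∣roots∣≡n Γ S indeg≤1) ⟩
    ∣ S ∣ + ∣ roots Γ S ∣    ≡⟨ cong (λ R → ∣ S ∣ + ∣ R ∣) roots≡W ⟩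
    ∣ S ∣ + ∣ W ∣             ∎)
    where open ≤-Reasoning

proposition4 : (Γ : Digraph) (W : VSet Γ) →
    ((∃ λ S → IsMaxOutForest Γ S × IsRootSet Γ S W) → IsVertexBasis Γ W) ×
    (IsVertexBasis Γ W → ∃ λ S → IsMaxOutForest Γ S × IsRootSet Γ S W)
proposition4 Γ W = rootsOfMax⇒basis , basis⇒rootsOfMax
  where
  rootsOfMax⇒basis : (∃ λ S → IsMaxOutForest Γ S × IsRootSet Γ S W) → IsVertexBasis Γ W
  rootsOfMax⇒basis (S , max , W-roots) =
    subst (IsVertexBasis Γ) (sym (isRootSet⇒≡roots Γ S W-roots))
          (maxOutForest⇒roots-isVertexBasis Γ S max)
  basis⇒rootsOfMax : IsVertexBasis Γ W → ∃ λ S → IsMaxOutForest Γ S × IsRootSet Γ S W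
  basis⇒rootsOfMax basis with vertexBasis⇒maxOutForest Γ W basis
  ... | S , max , roots≡W = S , max , subst (IsRootSet Γ S) roots≡W (roots-isRootSet Γ S)
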